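{- Every $4$-regular graph with girth at least $6$ has a strong edge-coloring with at most $22$ colors.
   Context: A strong edge-coloring is an assignment of colors to edges such that any two distinct edges that share an endpoint, or that are joined by an edge, receive different colors. The girth is the length of a shortest cycle. -}

module Defs where

open import Data.Bool using (Bool; true; false; T)
open import Data.Nat using (ℕ; zero; suc; _<_; _≤_)
open import Data.Fin using (Fin; toℕ)
open import Data.List using (List; length; filterᵇ; allFin)
open import Data.Product using (Σ; Σ-syntax; ∃-syntax; _×_; _,_; proj₁; proj₂)
open import Data.Sum using (_⊎_)
open import Relation.Binary.PropositionalEquality using (_≡_; _≢_)
open import Relation.Nullary using (¬_)

record Graph : Set where
  field
    n     : ℕ
    adj   : Fin n → Fin n → Bool
    sym   : ∀ u v → adj u v ≡ adj v u
    irrefl : ∀ u → adj u u ≡ false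

open Graph public

Adj : (G : Graph) → Fin (n G) → Fin (n G) → Set
Adj G u v = T (adj G u v)

degree : (G : Graph) → Fin (n G) → ℕ
degree G u = length (filterᵇ (adj G u) (allFin (n G)))

Regular : ℕ → Graph → Set
Regular d G = ∀ u → degree G u ≡ d

IsCycle : (G : Graph) → ℕ → (ℕ → Fin (n G)) → Set
IsCycle G k c =
  3 ≤ k
  × (∀ i j → i < k → j < k → c i ≡ c j → i ≡ j)
  × (∀ i → i < k → Adj G (c i) (c (suc i)))
  × (c k ≡ c 0)

HasCycleOfLength : Graph → ℕ → Set
HasCycleOfLength G k = ∃[ c ] IsCycle G k c

GirthAtLeast : ℕ → Graph → Set
GirthAtLeast g G = ∀ k → k < g → ¬ HasCycleOfLength G k

-- An edge {u,v}, represented canonically with u < v.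
Edge : Graph → Set
Edge G = Σ[ u ∈ Fin (n G) ] Σ[ v ∈ Fin (n G) ] (toℕ u < toℕ v × Adj G u v)

ends₁ : ∀ G → Edge G → Fin (n G)
ends₁ G e = proj₁ e

ends₂ : ∀ G → Edge G → Fin (n G)
ends₂ G e = proj₁ (proj₂ e)

IsEndpoint : ∀ {G : Graph} → Fin (n G) → Edge G → Set
IsEndpoint {G} x e = x ≡ ends₁ G e ⊎ x ≡ ends₂ G e

DistinctEdges : ∀ {G : Graph} → Edge G → Edge G → Set
DistinctEdges {G} e f = ¬ (ends₁ G e ≡ ends₁ G f × ends₂ G e ≡ ends₂ G f)

Close : (G : Graph) → Edge G → Edge G → Set
Close G e f = ∃[ x ] ∃[ y ] (IsEndpoint {G} x e × IsEndpoint {G} y f × (x ≡ y ⊎ Adj G x y))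

IsStrongEdgeColoring : (G : Graph) (k : ℕ) → (Edge G → Fin k) → Set
IsStrongEdgeColoring G k col =
  ∀ e f → DistinctEdges {G} e f → Close G e f → col e ≢ col f

HasStrongEdgeColoring : Graph → ℕ → Set
HasStrongEdgeColoring G k = ∃[ col ] IsStrongEdgeColoring G k col

-- Pick a maximal set of roots at pairwise distance at least 6, so that every vertex lies within
-- distance 5 of a root; call this distance its level. Join every neighbour of a root to one of its
-- non-root neighbours by a special edge. Two special edges are never close: near a common root this
-- would create a cycle of length at most 5, near distinct roots it would put them at distance at
-- most 5. So the special edges share one colour, and the remaining edges are coloured greedily
-- from 21 further colours, in decreasing order of the level of their lower endpoint u. Of the at
-- most 24 edges close to uv, four are still uncoloured at that moment: if u is not a root, the
-- edges at a neighbour of u of smaller level; if u is a root, the special edges at the other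
-- neighbours of u and at v. Hence at most 20 colours are forbidden.
module Submission where

open import Defs hiding (sym)
open import Data.Bool using (Bool; true; false; T; _∨_; _∧_; if_then_else_)
open import Data.Bool.ListAction using (any)
open import Data.Bool.Properties using (T?; T-∨; T-∧)
open import Data.Empty using (⊥; ⊥-elim)
open import Data.Fin as Fin using (Fin; _≟_)
open import Data.Fin.Properties as Finₚ using (pigeonhole; any?)
open import Data.List using (List; []; _∷_; _∷ʳ_; _++_; length; filter; filterᵇ; allFin; lookup; mapMaybe; concatMap; find; foldl; cartesianProduct)
open import Data.List.Properties using (length-++; length-mapMaybe; mapMaybe-cong; mapMaybe-nothing; filter-notAll)
open import Data.List.Membership.Propositional using (_∈_; _∉_)
open import Data.List.Membership.Propositional.Properties using (∈-++⁺ˡ; ∈-++⁺ʳ; ∈-filter⁺; ∈-filter⁻; ∈-allFin; ∈-concatMap⁺; ∈-cartesianProduct⁺)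
import Data.List.Membership.DecPropositional as DecMembership
open import Data.List.Relation.Unary.All as All using ([]; _∷_)
open import Data.List.Relation.Unary.AllPairs using ([]; _∷_)
open import Data.List.Relation.Unary.Any as Any using (here; there; index)
open import Data.List.Relation.Unary.Any.Properties using (lookup-index; any⁺; any⁻)
open import Data.List.Relation.Unary.Linked using (Linked; []; [-]; _∷_)
open import Data.List.Relation.Unary.Unique.Propositional using (Unique)
import Data.List.Relation.Unary.Unique.Propositional.Properties as Unique
open import Data.Maybe using (Maybe; just; nothing)
open import Data.Maybe.Properties using (≡-dec; just-injective)
open import Data.Nat using (ℕ; zero; suc; _+_; _*_; _≤_; _<_; _≤′_; ≤′-refl; ≤′-step; z≤n; s≤s; _≤?_) renaming (_≟_ to _≟ℕ_)
open import Data.Nat.Properties hiding (_≟_)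
open import Data.Product using (∃-syntax; _×_; _,_; proj₁; proj₂)
open import Data.Sum using (_⊎_; inj₁; inj₂; [_,_])
open import Function using (_∘_; id; Equivalence)
open import Relation.Binary.PropositionalEquality using (_≡_; _≢_; refl; sym; trans; cong; subst; ≢-sym; module ≡-Reasoning)
open import Relation.Nullary using (¬_; Dec; yes; no; does; ¬?)
open import Relation.Nullary.Decidable using (decidable-stable; from-yes; _×-dec_; _⊎-dec_)

private variable
  A B : Set

module _ (f : A → Maybe B) where

  ∈-mapMaybe⁺ : ∀ {xs x y} → x ∈ xs → f x ≡ just y → y ∈ mapMaybe f xs
  ∈-mapMaybe⁺ {x ∷ xs} (here refl) fx≡y rewrite fx≡y = here refl
  ∈-mapMaybe⁺ {x ∷ xs} (there p) fx≡y with f x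
  ... | just _  = there (∈-mapMaybe⁺ p fx≡y)
  ... | nothing = ∈-mapMaybe⁺ p fx≡y

  length-mapMaybe-< : ∀ {xs x} → x ∈ xs → f x ≡ nothing → length (mapMaybe f xs) < length xs
  length-mapMaybe-< {x ∷ xs} (here refl) fx≡nothing rewrite fx≡nothing = s≤s (length-mapMaybe f xs)
  length-mapMaybe-< {x ∷ xs} (there p) fx≡nothing with f x
  ... | just _  = s≤s (length-mapMaybe-< p fx≡nothing)
  ... | nothing = m<n⇒m<1+n (length-mapMaybe-< p fx≡nothing)

module _ (f : A → List B) {k : ℕ} where

  length-concatMap-≤ : ∀ xs → (∀ {x} → x ∈ xs → length (f x) ≤ k) → length (concatMap f xs) ≤ length xs * k
  length-concatMap-≤ []       _     = z≤n
  length-concatMap-≤ (x ∷ xs) bound = begin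
    length (f x ++ concatMap f xs)        ≡⟨ length-++ (f x) ⟩
    length (f x) + length (concatMap f xs) ≤⟨ +-mono-≤ (bound (here refl)) (length-concatMap-≤ xs (bound ∘ there)) ⟩
    k + length xs * k                     ∎
    where open ≤-Reasoning

  length-concatMap-[] : ∀ {xs x} → x ∈ xs → f x ≡ [] → (∀ {x} → x ∈ xs → length (f x) ≤ k) →
                        length (concatMap f xs) + k ≤ length xs * k
  length-concatMap-[] {x ∷ xs} (here refl) fx≡[] bound rewrite fx≡[] = begin
    length (concatMap f xs) + k ≤⟨ +-monoˡ-≤ k (length-concatMap-≤ xs (bound ∘ there)) ⟩
    length xs * k + k          ≡⟨ +-comm (length xs * k) k ⟩
    k + length xs * k          ∎
    where open ≤-Reasoning
  length-concatMap-[] {y ∷ xs} (there p) fx≡[] bound = begin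
    length (f y ++ concatMap f xs) + k         ≡⟨ cong (_+ k) (length-++ (f y)) ⟩
    length (f y) + length (concatMap f xs) + k ≡⟨ +-assoc (length (f y)) _ k ⟩
    length (f y) + (length (concatMap f xs) + k)
      ≤⟨ +-mono-≤ (bound (here refl)) (length-concatMap-[] p fx≡[] (bound ∘ there)) ⟩
    k + length xs * k                          ∎
    where open ≤-Reasoning

module _ {P : A → Set} (P? : ∀ x → Dec (P x)) where

  find-sound : ∀ {xs y} → find P? xs ≡ just y → y ∈ xs × P y
  find-sound {x ∷ xs} eq with P? x
  find-sound {x ∷ xs} refl | yes px = here refl , px
  ... | no _ = let (y∈xs , py) = find-sound eq in there y∈xs , py

  find-complete : ∀ {xs x} → x ∈ xs → P x → ∃[ y ] find P? xs ≡ just y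
  find-complete {y ∷ xs} x∈xs px with P? y
  ... | yes _ = y , refl
  find-complete {y ∷ xs} (here refl) px | no ¬py = ⊥-elim (¬py px)
  find-complete {y ∷ xs} (there x∈xs) px | no _ = find-complete x∈xs px

walkAt : A → List A → ℕ → A
walkAt d []       _       = d
walkAt d (x ∷ xs) zero    = x
walkAt d (x ∷ xs) (suc i) = walkAt d xs i

walkAt-length : ∀ (d : A) xs → walkAt d xs (length xs) ≡ d
walkAt-length d []       = refl
walkAt-length d (x ∷ xs) = walkAt-length d xs

walkAt-∈ : ∀ (d : A) xs {i} → i < length xs → walkAt d xs i ∈ xs
walkAt-∈ d (x ∷ xs) {zero}  _          = here refl
walkAt-∈ d (x ∷ xs) {suc i} (s≤s i<n) = there (walkAt-∈ d xs i<n)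

walkAt-injective : ∀ (d : A) {xs} → Unique xs → ∀ {i j} → i < length xs → j < length xs →
                   walkAt d xs i ≡ walkAt d xs j → i ≡ j
walkAt-injective d (_ ∷ _) {zero} {zero} _ _ _ = refl
walkAt-injective d {_ ∷ xs} (x≢xs ∷ _) {zero} {suc j} _ (s≤s j<n) eq =
  ⊥-elim (All.lookup x≢xs (walkAt-∈ d xs j<n) eq)
walkAt-injective d {_ ∷ xs} (x≢xs ∷ _) {suc i} {zero} (s≤s i<n) _ eq =
  ⊥-elim (All.lookup x≢xs (walkAt-∈ d xs i<n) (sym eq))
walkAt-injective d (_ ∷ unique) {suc i} {suc j} (s≤s i<n) (s≤s j<n) eq =
  cong suc (walkAt-injective d unique i<n j<n eq)

walkAt-linked : ∀ {R : A → A → Set} d xs → Linked R (xs ∷ʳ d) → ∀ {i} → i < length xs →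
                R (walkAt d xs i) (walkAt d xs (suc i))
walkAt-linked d (x ∷ [])     (xd ∷ [-])  {zero}  _          = xd
walkAt-linked d (x ∷ [])     _           {suc i} (s≤s ())
walkAt-linked d (x ∷ y ∷ xs) (xy ∷ _)    {zero}  _          = xy
walkAt-linked d (x ∷ y ∷ xs) (_ ∷ linked) {suc i} (s≤s i<n) = walkAt-linked d (y ∷ xs) linked i<n

module _ {k : ℕ} where

  covering-length : (F : List (Fin k)) → (∀ c → c ∈ F) → k ≤ length F
  covering-length F covers = ≮⇒≥ λ short →
    let (i , j , i<j , same-index) = pigeonhole short (index ∘ covers)
    in <-irrefl (cong Fin.toℕ (begin
         i                          ≡⟨ lookup-index (covers i) ⟩
         lookup F (index (covers i)) ≡⟨ cong (lookup F) same-index ⟩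
         lookup F (index (covers j)) ≡⟨ sym (lookup-index (covers j)) ⟩
         j                          ∎)) i<j
    where open ≡-Reasoning

module _ {k : ℕ} where

  open DecMembership (_≟_ {suc k}) using (_∈?_)

  firstFree : List (Fin (suc k)) → Fin (suc k)
  firstFree F with any? (λ c → ¬? (c ∈? F))
  ... | yes (c , _) = c
  ... | no _        = Fin.zero

  firstFree-∉ : (F : List (Fin (suc k))) → length F ≤ k → firstFree F ∉ F
  firstFree-∉ F short with any? (λ c → ¬? (c ∈? F))
  ... | yes (_ , c∉F) = c∉F
  ... | no none = ⊥-elim (<⇒≱ (s≤s short)
    (covering-length F λ c → decidable-stable (c ∈? F) λ c∉F → none (c , c∉F)))

module Basics (G : Graph) where

  V : Set
  V = Fin (n G)

  Adj-sym : ∀ {x y} → Adj G x y → Adj G y x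
  Adj-sym {x} {y} = subst T (Graph.sym G x y)

  adj⇒≢ : ∀ {x y} → Adj G x y → x ≢ y
  adj⇒≢ {x} xx refl = subst T (irrefl G x) xx

  Near : V → V → Set
  Near x y = x ≡ y ⊎ Adj G x y

  Near-sym : ∀ {x y} → Near x y → Near y x
  Near-sym (inj₁ refl) = inj₁ refl
  Near-sym (inj₂ xy)   = inj₂ (Adj-sym xy)

  -- Close G e f unfolds to CloseV applied to the endpoints of e and f.
  CloseV : V → V → V → V → Set
  CloseV a b c d = ∃[ x ] ∃[ y ] ((x ≡ a ⊎ x ≡ b) × (y ≡ c ⊎ y ≡ d) × Near x y)

  CloseV-sym : ∀ {a b c d} → CloseV a b c d → CloseV c d a b
  CloseV-sym (x , y , x∈ab , y∈cd , xy) = y , x , y∈cd , x∈ab , Near-sym xy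

  CloseV-swapˡ : ∀ {a b c d} → CloseV a b c d → CloseV b a c d
  CloseV-swapˡ (x , y , inj₁ x≡a , y∈cd , xy) = x , y , inj₂ x≡a , y∈cd , xy
  CloseV-swapˡ (x , y , inj₂ x≡b , y∈cd , xy) = x , y , inj₁ x≡b , y∈cd , xy

  CloseV-swapʳ : ∀ {a b c d} → CloseV a b c d → CloseV a b d c
  CloseV-swapʳ = CloseV-sym ∘ CloseV-swapˡ ∘ CloseV-sym

  SameEdge : V → V → V → V → Set
  SameEdge a b c d = (a ≡ c × b ≡ d) ⊎ (a ≡ d × b ≡ c)

  SameEdge-swapˡ : ∀ {a b c d} → SameEdge a b c d → SameEdge b a c d
  SameEdge-swapˡ (inj₁ (a≡c , b≡d)) = inj₂ (b≡d , a≡c)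
  SameEdge-swapˡ (inj₂ (a≡d , b≡c)) = inj₁ (b≡c , a≡d)

  SameEdge-swapʳ : ∀ {a b c d} → SameEdge a b c d → SameEdge a b d c
  SameEdge-swapʳ (inj₁ (a≡c , b≡d)) = inj₂ (a≡c , b≡d)
  SameEdge-swapʳ (inj₂ (a≡d , b≡c)) = inj₁ (a≡d , b≡c)

  sameEdge? : ∀ a b c d → Dec (SameEdge a b c d)
  sameEdge? a b c d = (a ≟ c ×-dec b ≟ d) ⊎-dec (a ≟ d ×-dec b ≟ c)

  SameEdge-join : ∀ {u v a b c d} → SameEdge u v a b → SameEdge u v c d → SameEdge a b c d
  SameEdge-join (inj₁ (refl , refl)) (inj₁ (refl , refl)) = inj₁ (refl , refl)
  SameEdge-join (inj₁ (refl , refl)) (inj₂ (refl , refl)) = inj₂ (refl , refl)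
  SameEdge-join (inj₂ (refl , refl)) (inj₁ (refl , refl)) = inj₂ (refl , refl)
  SameEdge-join (inj₂ (refl , refl)) (inj₂ (refl , refl)) = inj₁ (refl , refl)

  CloseV-SameEdge : ∀ {u v a b c d} → SameEdge u v a b → CloseV a b c d → CloseV u v c d
  CloseV-SameEdge (inj₁ (refl , refl)) = id
  CloseV-SameEdge (inj₂ (refl , refl)) = CloseV-swapˡ

  cycle-of-walk : ∀ x xs → 3 ≤ length (x ∷ xs) → Unique (x ∷ xs) → Linked (Adj G) ((x ∷ xs) ∷ʳ x) →
                  HasCycleOfLength G (length (x ∷ xs))
  cycle-of-walk x xs three unique linked =
    walkAt x (x ∷ xs) , three , (λ _ _ → walkAt-injective x unique) ,
    (λ _ → walkAt-linked x (x ∷ xs) linked) , walkAt-length x (x ∷ xs)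

module Girth (G : Graph) (girth : GirthAtLeast 6 G) where

  open Basics G

  private
    no-short-cycle : ∀ x xs → 3 ≤ length (x ∷ xs) → length (x ∷ xs) < 6 → Unique (x ∷ xs) →
                     Linked (Adj G) ((x ∷ xs) ∷ʳ x) → ⊥
    no-short-cycle x xs three short unique linked = girth _ short (cycle-of-walk x xs three unique linked)

  no-triangle : ∀ {a b c} → Adj G a b → Adj G b c → Adj G c a → ⊥
  no-triangle ab bc ca =
    no-short-cycle _ (_ ∷ _ ∷ []) (from-yes (3 ≤? 3)) (from-yes (4 ≤? 6))
      ((adj⇒≢ ab ∷ ≢-sym (adj⇒≢ ca) ∷ []) ∷ (adj⇒≢ bc ∷ []) ∷ [] ∷ [])
      (ab ∷ bc ∷ ca ∷ [-])

  no-square : ∀ {a b c d} → Adj G a b → Adj G b c → Adj G c d → Adj G d a → a ≢ c → b ≢ d → ⊥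
  no-square ab bc cd da a≢c b≢d =
    no-short-cycle _ (_ ∷ _ ∷ _ ∷ []) (from-yes (3 ≤? 4)) (from-yes (5 ≤? 6))
      ((adj⇒≢ ab ∷ a≢c ∷ ≢-sym (adj⇒≢ da) ∷ []) ∷ (adj⇒≢ bc ∷ b≢d ∷ []) ∷
       (adj⇒≢ cd ∷ []) ∷ [] ∷ [])
      (ab ∷ bc ∷ cd ∷ da ∷ [-])

  no-pentagon : ∀ {a b c d e} → Adj G a b → Adj G b c → Adj G c d → Adj G d e → Adj G e a →
                a ≢ c → a ≢ d → b ≢ d → b ≢ e → c ≢ e → ⊥
  no-pentagon ab bc cd de ea a≢c a≢d b≢d b≢e c≢e =
    no-short-cycle _ (_ ∷ _ ∷ _ ∷ _ ∷ []) (from-yes (3 ≤? 5)) (from-yes (6 ≤? 6))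
      ((adj⇒≢ ab ∷ a≢c ∷ a≢d ∷ ≢-sym (adj⇒≢ ea) ∷ []) ∷ (adj⇒≢ bc ∷ b≢d ∷ b≢e ∷ []) ∷
       (adj⇒≢ cd ∷ c≢e ∷ []) ∷ (adj⇒≢ de ∷ []) ∷ [] ∷ [])
      (ab ∷ bc ∷ cd ∷ de ∷ ea ∷ [-])

  private
    near-hanging : ∀ {r a b y} → Adj G a r → Adj G b r → Adj G b y → y ≢ r → a ≢ b → Near a y → ⊥
    near-hanging ar br by y≢r a≢b (inj₁ refl) = no-triangle (Adj-sym by) br (Adj-sym ar)
    near-hanging ar br by y≢r a≢b (inj₂ ay)   = no-square (Adj-sym ar) ay (Adj-sym by) br (≢-sym y≢r) a≢b

  hanging-edges-not-close : ∀ {r a x b y} → Adj G a r → Adj G b r → Adj G a x → x ≢ r →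
                            Adj G b y → y ≢ r → a ≢ b → ¬ CloseV a x b y
  hanging-edges-not-close ar br ax x≢r by y≢r a≢b (_ , _ , inj₁ refl , inj₁ refl , inj₁ refl) = a≢b refl
  hanging-edges-not-close ar br ax x≢r by y≢r a≢b (_ , _ , inj₁ refl , inj₁ refl , inj₂ ab) =
    no-triangle ab br (Adj-sym ar)
  hanging-edges-not-close ar br ax x≢r by y≢r a≢b (_ , _ , inj₁ refl , inj₂ refl , ay) =
    near-hanging ar br by y≢r a≢b ay
  hanging-edges-not-close ar br ax x≢r by y≢r a≢b (_ , _ , inj₂ refl , inj₁ refl , xb) =
    near-hanging br ar ax x≢r (≢-sym a≢b) (Near-sym xb)
  hanging-edges-not-close ar br ax x≢r by y≢r a≢b (_ , _ , inj₂ refl , inj₂ refl , inj₁ refl) =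
    no-square (Adj-sym ar) ax (Adj-sym by) br (≢-sym x≢r) a≢b
  hanging-edges-not-close {r} {a} {x} {b} {y} ar br ax x≢r by y≢r a≢b (_ , _ , inj₂ refl , inj₂ refl , inj₂ xy)
    with a ≟ y | x ≟ b
  ... | yes refl | _        = no-triangle (Adj-sym by) br (Adj-sym ar)
  ... | no _     | yes refl = no-triangle ax br (Adj-sym ar)
  ... | no a≢y   | no x≢b   =
    no-pentagon (Adj-sym ar) ax xy (Adj-sym by) br (≢-sym x≢r) (≢-sym y≢r) a≢y a≢b x≢b

module Balls (G : Graph) where

  open Basics G
  open Equivalence using (to; from)

  within : ℕ → (V → Bool) → V → Bool
  within zero    X w = X w
  within (suc k) X w = within k X w ∨ any (λ t → adj G w t ∧ within k X t) (allFin (n G))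

  -- Wrapped in a record because T is not injective: this way k, X and w can be inferred.
  record Within (k : ℕ) (X : V → Bool) (w : V) : Set where
    constructor ⟨_⟩
    field holds : T (within k X w)

  open Within public

  private variable
    k j : ℕ
    X Y : V → Bool
    w t : V

  within-suc : Within k X w → Within (suc k) X w
  within-suc {k} {X} {w} ⟨ h ⟩ = ⟨ from (T-∨ {within k X w}) (inj₁ h) ⟩

  within-step : Within k X t → Adj G w t → Within (suc k) X w
  within-step {k} {X} {t} {w} ⟨ h ⟩ wt =
    ⟨ from (T-∨ {within k X w}) (inj₂ (any⁺ _ (Any.map (λ { refl → from T-∧ (wt , h) }) (∈-allFin t)))) ⟩

  within-near : Within k X t → Near t w → Within (suc k) X w
  within-near h (inj₁ refl) = within-suc h
  within-near h (inj₂ tw)   = within-step h (Adj-sym tw)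

  within-pred : Within (suc k) X w → Within k X w ⊎ ∃[ t ] Adj G w t × Within k X t
  within-pred {k} {X} {w} ⟨ h ⟩ with to (T-∨ {within k X w}) h
  ... | inj₁ here′ = inj₁ ⟨ here′ ⟩
  ... | inj₂ step  with t , wt×h ← Any.satisfied (any⁻ _ (allFin (n G)) step) =
    inj₂ (t , proj₁ (to T-∧ wt×h) , ⟨ proj₂ (to T-∧ wt×h) ⟩)

  within-≤ : k ≤ j → Within k X w → Within j X w
  within-≤ k≤j = go (≤⇒≤′ k≤j)
    where
    go : k ≤′ j → Within k X w → Within j X w
    go ≤′-refl      h = h
    go (≤′-step le) h = within-suc (go le h)

  within-⊆ : (∀ {t} → T (X t) → T (Y t)) → Within k X w → Within k Y w
  within-⊆ {k = zero} X⊆Y ⟨ h ⟩ = ⟨ X⊆Y h ⟩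
  within-⊆ {k = suc k} X⊆Y h with within-pred h
  ... | inj₁ h′           = within-suc (within-⊆ X⊆Y h′)
  ... | inj₂ (t , wt , h′) = within-step (within-⊆ X⊆Y h′) wt

  singleton : V → V → Bool
  singleton r w = does (w ≟ r)

  singleton-self : ∀ r → T (singleton r r)
  singleton-self r with r ≟ r
  ... | yes _   = _
  ... | no r≢r = r≢r refl

  singleton-⊆ : ∀ {X : V → Bool} {r t} → T (X r) → T (singleton r t) → T (X t)
  singleton-⊆ {r = r} {t} xr h with t ≟ r
  ... | yes refl = xr

  centre : ∀ r → Within 0 (singleton r) r
  centre r = ⟨ singleton-self r ⟩

module Roots (G : Graph) (d : ℕ) where

  open Basics G
  open Balls G
  open Equivalence using (to; from)

  -- Within d is symmetric; requiring both directions merely saves proving it.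
  Scattered : (V → Bool) → Set
  Scattered X = ∀ {r s} → T (X r) → T (X s) → r ≢ s →
                Within d (singleton r) s → Within d (singleton s) r → ⊥

  insert : V → (V → Bool) → V → Bool
  insert w X t = X t ∨ singleton w t

  insert-∈ : ∀ {w X t} → T (insert w X t) → T (X t) ⊎ t ≡ w
  insert-∈ {w} {X} {t} h with to (T-∨ {X t}) h
  ... | inj₁ xt = inj₁ xt
  ... | inj₂ _  with t ≟ w
  ...   | yes t≡w = inj₂ t≡w

  grow : (V → Bool) → V → V → Bool
  grow X w = if within d X w then X else insert w X

  grow-⊇ : ∀ X w {t} → T (X t) → T (grow X w t)
  grow-⊇ X w {t} h with within d X w
  ... | true  = h
  ... | false = from (T-∨ {X t}) (inj₁ h)

  grow-covers : ∀ X w → Within d (grow X w) w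
  grow-covers X w with within d X w in eq
  ... | true  = ⟨ subst T (sym eq) _ ⟩
  ... | false = within-≤ z≤n ⟨ from (T-∨ {X w}) (inj₂ (singleton-self w)) ⟩

  grow-scattered : ∀ X w → Scattered X → Scattered (grow X w)
  grow-scattered X w scattered with within d X w in eq
  ... | true  = scattered
  ... | false = λ hr hs → go (insert-∈ {w} {X} hr) (insert-∈ {w} {X} hs)
    where
    far : ∀ {r} → T (X r) → ¬ Within d (singleton r) w
    far xr r→w = subst T eq (holds (within-⊆ (singleton-⊆ {X} xr) r→w))
    go : ∀ {r s} → T (X r) ⊎ r ≡ w → T (X s) ⊎ s ≡ w → r ≢ s →
         Within d (singleton r) s → Within d (singleton s) r → ⊥
    go (inj₁ xr)   (inj₁ xs)   r≢s r→s s→r = scattered xr xs r≢s r→s s→r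
    go (inj₁ xr)   (inj₂ refl) _   r→s _   = far xr r→s
    go (inj₂ refl) (inj₁ xs)   _   _   s→r = far xs s→r
    go (inj₂ refl) (inj₂ refl) r≢s _   _   = r≢s refl

  private
    foldl-grow-⊇ : ∀ ws X {t} → T (X t) → T (foldl grow X ws t)
    foldl-grow-⊇ []       X h = h
    foldl-grow-⊇ (w ∷ ws) X h = foldl-grow-⊇ ws (grow X w) (grow-⊇ X w h)

    foldl-grow-scattered : ∀ ws X → Scattered X → Scattered (foldl grow X ws)
    foldl-grow-scattered []       X scattered = scattered
    foldl-grow-scattered (w ∷ ws) X scattered = foldl-grow-scattered ws (grow X w) (grow-scattered X w scattered)

    foldl-grow-covers : ∀ ws X {w} → w ∈ ws → Within d (foldl grow X ws) w
    foldl-grow-covers (w ∷ ws) X (here refl) = within-⊆ (foldl-grow-⊇ ws (grow X w)) (grow-covers X w)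
    foldl-grow-covers (_ ∷ ws) X (there w∈ws) = foldl-grow-covers ws _ w∈ws

  -- Opaque, since their unfoldings are huge and would slow down every later with-abstraction.
  opaque
    roots : V → Bool
    roots = foldl grow (λ _ → false) (allFin (n G))

    roots-scattered : Scattered roots
    roots-scattered = foldl-grow-scattered (allFin (n G)) _ λ ()

    roots-cover : ∀ w → Within d roots w
    roots-cover w = foldl-grow-covers (allFin (n G)) _ (∈-allFin w)

  private
    search : ℕ → V → ℕ
    search zero    w = 0
    search (suc k) w = if within k roots w then search k w else suc k

    search-≤ : ∀ k w → search k w ≤ k
    search-≤ zero    w = z≤n
    search-≤ (suc k) w with within k roots w
    ... | true  = m≤n⇒m≤1+n (search-≤ k w)
    ... | false = ≤-refl

    search-within : ∀ {k w} → Within k roots w → Within (search k w) roots w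
    search-within {zero}  h = h
    search-within {suc k} {w} h with within k roots w in eq
    ... | true  = search-within {k} {w} ⟨ subst T (sym eq) _ ⟩
    ... | false = h

    search-least : ∀ k w {j} → j < search k w → ¬ Within j roots w
    search-least (suc k) w j<s h with within k roots w in eq
    ... | true  = search-least k w j<s h
    ... | false = subst T eq (holds (within-≤ (≤-pred j<s) h))

  opaque
    level : V → ℕ
    level w = search d w

    level-≤ : ∀ w → level w ≤ d
    level-≤ w = search-≤ d w

    level-least : ∀ {j w} → Within j roots w → level w ≤ j
    level-least {w = w} h = ≮⇒≥ λ j<level → search-least d w j<level h

    level-within : ∀ w → Within (level w) roots w
    level-within w = search-within (roots-cover w)

  level-zero : ∀ {w} → level w ≡ 0 → T (roots w)
  level-zero {w} level≡0 = holds (subst (λ k → Within k roots w) level≡0 (level-within w))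

  level-suc : ∀ {j w} → level w ≡ suc j → ∃[ t ] Adj G w t × level t ≤ j
  level-suc {j} {w} level≡1+j with within-pred (subst (λ k → Within k roots w) level≡1+j (level-within w))
  ... | inj₁ h            = ⊥-elim (1+n≰n (subst (_≤ j) level≡1+j (level-least h)))
  ... | inj₂ (t , wt , h) = t , wt , level-least h

module ForbiddenColours (G : Graph) (regular : Regular 4 G) where

  open Basics G

  N : V → List V
  N x = filterᵇ (adj G x) (allFin (n G))

  ∈-N⁺ : ∀ {x y} → Adj G x y → y ∈ N x
  ∈-N⁺ {x} {y} xy = ∈-filter⁺ (T? ∘ adj G x) (∈-allFin y) xy

  ∈-N⁻ : ∀ {x y} → y ∈ N x → Adj G x y
  ∈-N⁻ {x} y∈N = proj₂ (∈-filter⁻ (T? ∘ adj G x) {xs = allFin (n G)} y∈N)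

  N-unique : ∀ x → Unique (N x)
  N-unique x = Unique.filter⁺ (T? ∘ adj G x) {allFin (n G)} (Unique.allFin⁺ (n G))

  others : V → V → List V
  others x w = filter (λ y → ¬? (y ≟ w)) (N x)

  ∈-others⁺ : ∀ {x y w} → Adj G x y → y ≢ w → y ∈ others x w
  ∈-others⁺ xy y≢w = ∈-filter⁺ (λ y → ¬? (y ≟ _)) (∈-N⁺ xy) y≢w

  ∈-others⁻ : ∀ {x y w} → y ∈ others x w → Adj G x y × y ≢ w
  ∈-others⁻ y∈others with y∈N , y≢w ← ∈-filter⁻ (λ y → ¬? (y ≟ _)) y∈others = ∈-N⁻ y∈N , y≢w

  neighbour-other-than : ∀ x r → ∃[ t ] Adj G x t × t ≢ r
  neighbour-other-than x r = go (N x) (N-unique x) (regular x) ∈-N⁻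
    where
    go : ∀ xs → Unique xs → length xs ≡ 4 → (∀ {t} → t ∈ xs → Adj G x t) → ∃[ t ] Adj G x t × t ≢ r
    go (a ∷ b ∷ _) ((a≢b ∷ _) ∷ _) _ adjacent with a ≟ r
    ... | yes refl = b , adjacent (there (here refl)) , ≢-sym a≢b
    ... | no a≢r   = a , adjacent (here refl) , a≢r

  length-others : ∀ {x w} → Adj G x w → length (others x w) ≤ 3
  length-others {x} {w} xw = ≤-pred (subst (length (others x w) <_) (regular x)
    (filter-notAll (λ y → ¬? (y ≟ w)) (N x) (Any.map (λ { refl w≢w → w≢w refl }) (∈-N⁺ xw))))

  Colour : Set
  Colour = Fin 21

  PartialColouring : Set
  PartialColouring = V → V → Maybe Colour

  Symmetric : PartialColouring → Set
  Symmetric σ = ∀ a b → σ a b ≡ σ b a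

  coloursAt : PartialColouring → V → V → List Colour
  coloursAt σ a b = mapMaybe (σ a) (others a b)

  coloursBeyond : PartialColouring → V → V → List Colour
  coloursBeyond σ a b = concatMap (λ y → coloursAt σ y a) (others a b)

  forbidden : PartialColouring → V → V → List Colour
  forbidden σ u v = coloursAt σ u v ++ coloursAt σ v u ++ coloursBeyond σ u v ++ coloursBeyond σ v u

  private variable
    σ : PartialColouring
    u v c d : V
    x : Colour

  colour-near-∈ : Symmetric σ → Near u c → Adj G c d → σ c d ≡ just x → ¬ SameEdge u v c d →
                  x ∈ coloursAt σ u v ⊎ x ∈ coloursAt σ v u ⊎ x ∈ coloursBeyond σ u v
  colour-near-∈ {σ} {u} _ (inj₁ refl) cd cd↦x other =
    inj₁ (∈-mapMaybe⁺ (σ u) (∈-others⁺ cd λ { refl → other (inj₁ (refl , refl)) }) cd↦x)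
  colour-near-∈ {σ} {u} {c} {d} {x} {v} symmetric (inj₂ uc) cd cd↦x other with c ≟ v | d ≟ u
  ... | yes refl | _ =
    inj₂ (inj₁ (∈-mapMaybe⁺ (σ c) (∈-others⁺ cd λ { refl → other (inj₂ (refl , refl)) }) cd↦x))
  ... | no c≢v | yes refl =
    inj₁ (∈-mapMaybe⁺ (σ d) (∈-others⁺ uc c≢v) (trans (symmetric d c) cd↦x))
  ... | no c≢v | no d≢u =
    inj₂ (inj₂ (∈-concatMap⁺ (λ y → coloursAt σ y u)
                 (Any.map (λ { refl → ∈-mapMaybe⁺ (σ c) (∈-others⁺ cd d≢u) cd↦x })
                                       (∈-others⁺ uc c≢v))))

  private
    forbidden-∈ˡ : ∀ σ u v → x ∈ coloursAt σ u v ⊎ x ∈ coloursAt σ v u ⊎ x ∈ coloursBeyond σ u v →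
                   x ∈ forbidden σ u v
    forbidden-∈ˡ σ u v (inj₁ p)        = ∈-++⁺ˡ p
    forbidden-∈ˡ σ u v (inj₂ (inj₁ p)) = ∈-++⁺ʳ (coloursAt σ u v) (∈-++⁺ˡ p)
    forbidden-∈ˡ σ u v (inj₂ (inj₂ p)) = ∈-++⁺ʳ (coloursAt σ u v) (∈-++⁺ʳ (coloursAt σ v u) (∈-++⁺ˡ p))

    forbidden-∈ʳ : ∀ σ u v → x ∈ coloursAt σ v u ⊎ x ∈ coloursAt σ u v ⊎ x ∈ coloursBeyond σ v u →
                   x ∈ forbidden σ u v
    forbidden-∈ʳ σ u v (inj₁ p)        = ∈-++⁺ʳ (coloursAt σ u v) (∈-++⁺ˡ p)
    forbidden-∈ʳ σ u v (inj₂ (inj₁ p)) = ∈-++⁺ˡ p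
    forbidden-∈ʳ σ u v (inj₂ (inj₂ p)) =
      ∈-++⁺ʳ (coloursAt σ u v) (∈-++⁺ʳ (coloursAt σ v u) (∈-++⁺ʳ (coloursBeyond σ u v) p))

  forbidden-∈ : Symmetric σ → CloseV u v c d → Adj G c d → σ c d ≡ just x → ¬ SameEdge u v c d →
                x ∈ forbidden σ u v
  forbidden-∈ {σ} {u} {v} {c} {d} symmetric (_ , _ , u-or-v , c-or-d , near) cd cd↦x other
    with u-or-v | c-or-d
  ... | inj₁ refl | inj₁ refl = forbidden-∈ˡ σ u v (colour-near-∈ symmetric near cd cd↦x other)
  ... | inj₁ refl | inj₂ refl = forbidden-∈ˡ σ u v
    (colour-near-∈ symmetric near (Adj-sym cd) (trans (symmetric d c) cd↦x) (other ∘ SameEdge-swapʳ))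
  ... | inj₂ refl | inj₁ refl = forbidden-∈ʳ σ u v
    (colour-near-∈ symmetric near cd cd↦x (other ∘ SameEdge-swapˡ))
  ... | inj₂ refl | inj₂ refl = forbidden-∈ʳ σ u v
    (colour-near-∈ symmetric near (Adj-sym cd) (trans (symmetric d c) cd↦x) (other ∘ SameEdge-swapˡ ∘ SameEdge-swapʳ))

  BareAt : PartialColouring → V → Set
  BareAt σ p = ∀ z → σ p z ≡ nothing

  HasBareEdge : PartialColouring → V → V → Set
  HasBareEdge σ y u = ∃[ z ] Adj G y z × z ≢ u × σ y z ≡ nothing

  -- Either way, four of the at most 24 edges close to uv are still uncoloured.
  Slack : PartialColouring → V → V → Set
  Slack σ u v = (∃[ p ] Adj G u p × p ≢ v × BareAt σ p)
              ⊎ ((∀ {y} → Adj G u y → y ≢ v → HasBareEdge σ y u) × HasBareEdge σ v u)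

  private
    length-coloursAt : ∀ σ {a b} → Adj G a b → length (coloursAt σ a b) ≤ 3
    length-coloursAt σ {a} {b} ab = ≤-trans (length-mapMaybe (σ a) (others a b)) (length-others ab)

    length-coloursAt-bare : ∀ σ {a b} → Adj G a b → HasBareEdge σ a b → length (coloursAt σ a b) ≤ 2
    length-coloursAt-bare σ {a} ab (z , az , z≢b , az↦nothing) =
      ≤-pred (≤-trans (length-mapMaybe-< (σ a) (∈-others⁺ az z≢b) az↦nothing) (length-others ab))

    length-coloursBeyond : ∀ σ {a b} → Adj G a b → length (coloursBeyond σ a b) ≤ 9
    length-coloursBeyond σ {a} {b} ab =
      ≤-trans (length-concatMap-≤ _ (others a b) λ y∈ → length-coloursAt σ (Adj-sym (proj₁ (∈-others⁻ y∈))))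
              (*-monoˡ-≤ 3 (length-others ab))

    length-coloursBeyond-bareAt : ∀ σ {a b p} → Adj G a b → Adj G a p → p ≢ b → BareAt σ p →
                                  length (coloursBeyond σ a b) ≤ 6
    length-coloursBeyond-bareAt σ {a} {b} {p} ab ap p≢b bare = +-cancelʳ-≤ 3 _ 6
      (≤-trans (length-concatMap-[] _ (∈-others⁺ ap p≢b) nothing-at-p
                  λ y∈ → length-coloursAt σ (Adj-sym (proj₁ (∈-others⁻ y∈))))
               (*-monoˡ-≤ 3 (length-others ab)))
      where
      nothing-at-p : coloursAt σ p a ≡ []
      nothing-at-p = trans (mapMaybe-cong bare (others p a)) (mapMaybe-nothing (others p a))

    length-coloursBeyond-bareEdges : ∀ σ {a b} → Adj G a b →
                                     (∀ {y} → Adj G a y → y ≢ b → HasBareEdge σ y a) →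
                                     length (coloursBeyond σ a b) ≤ 6
    length-coloursBeyond-bareEdges σ {a} {b} ab bare =
      ≤-trans (length-concatMap-≤ _ (others a b) λ y∈ →
                 let (ay , y≢b) = ∈-others⁻ y∈ in length-coloursAt-bare σ (Adj-sym ay) (bare ay y≢b))
              (*-monoˡ-≤ 2 (length-others ab))

    length-forbidden-≡ : ∀ σ u v → length (forbidden σ u v) ≡
                         length (coloursAt σ u v) + (length (coloursAt σ v u) +
                           (length (coloursBeyond σ u v) + length (coloursBeyond σ v u)))
    length-forbidden-≡ σ u v
      rewrite length-++ (coloursAt σ u v) {coloursAt σ v u ++ coloursBeyond σ u v ++ coloursBeyond σ v u}
            | length-++ (coloursAt σ v u) {coloursBeyond σ u v ++ coloursBeyond σ v u}
            | length-++ (coloursBeyond σ u v) {coloursBeyond σ v u} = refl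

  length-forbidden : Symmetric σ → Adj G u v → Slack σ u v → length (forbidden σ u v) ≤ 20
  length-forbidden {σ} {u} {v} symmetric uv (inj₁ (p , up , p≢v , bare)) =
    ≤-trans (≤-reflexive (length-forbidden-≡ σ u v))
      (+-mono-≤ (length-coloursAt-bare σ uv (p , up , p≢v , trans (symmetric u p) (bare u)))
      (+-mono-≤ (length-coloursAt σ (Adj-sym uv))
      (+-mono-≤ (length-coloursBeyond-bareAt σ uv up p≢v bare) (length-coloursBeyond σ (Adj-sym uv)))))
  length-forbidden {σ} {u} {v} symmetric uv (inj₂ (bare-beyond-u , bare-at-v)) =
    ≤-trans (≤-reflexive (length-forbidden-≡ σ u v))
      (+-mono-≤ (length-coloursAt σ uv)
      (+-mono-≤ (length-coloursAt-bare σ (Adj-sym uv) bare-at-v)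
      (+-mono-≤ (length-coloursBeyond-bareEdges σ uv bare-beyond-u) (length-coloursBeyond σ (Adj-sym uv)))))

module Greedy (G : Graph) (regular : Regular 4 G)
              (Special : Fin (n G) → Fin (n G) → Set) (Special-sym : ∀ {a b} → Special a b → Special b a)
              (level : Fin (n G) → ℕ) where

  open Basics G
  open ForbiddenColours G regular

  record Proper (m : ℕ) (σ : PartialColouring) : Set where
    field
      symmetric : Symmetric σ
      support   : ∀ {a b x} → σ a b ≡ just x → Adj G a b × ¬ Special a b × m ≤ level a × m ≤ level b
      strong    : ∀ {a b c d x y} → σ a b ≡ just x → σ c d ≡ just y → ¬ SameEdge a b c d →
                  CloseV a b c d → x ≢ y

  open Proper

  private variable
    m j : ℕ
    σ : PartialColouring
    a b u v : V

  Proper-empty : ∀ m → Proper m (λ _ _ → nothing)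
  Proper-empty _ = record { symmetric = λ _ _ → refl ; support = λ () ; strong = λ () }

  Proper-weaken : j ≤ m → Proper m σ → Proper j σ
  Proper-weaken j≤m P = record
    { symmetric = symmetric P
    ; support   = λ ab↦x → let (ab , ¬special , ma , mb) = support P ab↦x
                           in ab , ¬special , ≤-trans j≤m ma , ≤-trans j≤m mb
    ; strong    = strong P
    }

  assign : PartialColouring → V → V → Colour → PartialColouring
  assign σ u v x a b with sameEdge? u v a b
  ... | yes _ = just x
  ... | no _  = σ a b

  extend : PartialColouring → V × V → PartialColouring
  extend σ (u , v) = assign σ u v (firstFree (forbidden σ u v))

  Ready : ℕ → V × V → Set
  Ready m (u , v) = Adj G u v × ¬ Special u v × m ≤ level u × m ≤ level v × (∀ {σ} → Proper m σ → Slack σ u v)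

  assign-proper : ∀ {x} → Proper m σ → Adj G u v → ¬ Special u v → m ≤ level u → m ≤ level v →
                  (∀ {c d y} → σ c d ≡ just y → ¬ SameEdge u v c d → CloseV u v c d → x ≢ y) →
                  Proper m (assign σ u v x)
  assign-proper {m} {σ} {u} {v} {x} P uv ¬special mu mv fresh =
    record { symmetric = symmetric′ ; support = support′ ; strong = strong′ }
    where
    symmetric′ : Symmetric (assign σ u v x)
    symmetric′ a b with sameEdge? u v a b | sameEdge? u v b a
    ... | yes _ | yes _  = refl
    ... | yes s | no ns  = ⊥-elim (ns (SameEdge-swapʳ s))
    ... | no ns | yes s  = ⊥-elim (ns (SameEdge-swapʳ s))
    ... | no _  | no _   = symmetric P a b

    support′ : ∀ {a b y} → assign σ u v x a b ≡ just y → Adj G a b × ¬ Special a b × m ≤ level a × m ≤ level b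
    support′ {a} {b} ab↦y with sameEdge? u v a b
    ... | yes (inj₁ (refl , refl)) = uv , ¬special , mu , mv
    ... | yes (inj₂ (refl , refl)) = Adj-sym uv , ¬special ∘ Special-sym , mv , mu
    ... | no _                     = support P ab↦y

    strong′ : ∀ {a b c d y z} → assign σ u v x a b ≡ just y → assign σ u v x c d ≡ just z →
              ¬ SameEdge a b c d → CloseV a b c d → y ≢ z
    strong′ {a} {b} {c} {d} ab↦y cd↦z other close with sameEdge? u v a b | sameEdge? u v c d
    ... | yes s | yes s′ = ⊥-elim (other (SameEdge-join s s′))
    ... | yes s | no ns′ with refl ← ab↦y = fresh cd↦z ns′ (CloseV-SameEdge s close)
    ... | no ns | yes s′ with refl ← cd↦z = ≢-sym (fresh ab↦y ns (CloseV-SameEdge s′ (CloseV-sym close)))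
    ... | no _  | no _   = strong P ab↦y cd↦z other close

  extend-proper : Proper m σ → Ready m (u , v) → Proper m (extend σ (u , v))
  extend-proper {m} {σ} {u} {v} P (uv , ¬special , mu , mv , slack) = assign-proper P uv ¬special mu mv fresh
    where
    fresh : ∀ {c d y} → σ c d ≡ just y → ¬ SameEdge u v c d → CloseV u v c d → firstFree (forbidden σ u v) ≢ y
    fresh cd↦y other close refl =
      firstFree-∉ (forbidden σ u v) (length-forbidden (symmetric P) uv (slack P))
        (forbidden-∈ (symmetric P) close (proj₁ (support P cd↦y)) cd↦y other)

  Coloured : PartialColouring → V → V → Set
  Coloured σ a b = ∃[ x ] σ a b ≡ just x

  private
    assign-keeps : ∀ σ u v x → Coloured σ a b → Coloured (assign σ u v x) a b
    assign-keeps {a} {b} σ u v x coloured with sameEdge? u v a b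
    ... | yes _ = x , refl
    ... | no _  = coloured

    assign-colours : ∀ σ u v x → Coloured (assign σ u v x) u v
    assign-colours σ u v x with sameEdge? u v u v
    ... | yes _ = x , refl
    ... | no ns = ⊥-elim (ns (inj₁ (refl , refl)))

  foldl-extend-proper : ∀ es → (∀ {e} → e ∈ es → Ready m e) → Proper m σ → Proper m (foldl extend σ es)
  foldl-extend-proper []       ready P = P
  foldl-extend-proper (e ∷ es) ready P = foldl-extend-proper es (ready ∘ there) (extend-proper P (ready (here refl)))

  foldl-extend-keeps : ∀ σ es → Coloured σ a b → Coloured (foldl extend σ es) a b
  foldl-extend-keeps σ []       coloured = coloured
  foldl-extend-keeps σ ((u , v) ∷ es) coloured =
    foldl-extend-keeps (extend σ (u , v)) es (assign-keeps σ u v _ coloured)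

  foldl-extend-colours : ∀ σ es → (u , v) ∈ es → Coloured (foldl extend σ es) u v
  foldl-extend-colours σ ((u , v) ∷ es) (here refl) = foldl-extend-keeps (extend σ (u , v)) es (assign-colours σ u v _)
  foldl-extend-colours σ (e ∷ es)       (there uv∈es) = foldl-extend-colours (extend σ e) es uv∈es

  module Phases (phase : ℕ → List (V × V)) (ready : ∀ {m e} → e ∈ phase m → Ready m e) where

    run : ℕ → PartialColouring → PartialColouring
    run zero    σ = foldl extend σ (phase 0)
    run (suc k) σ = run k (foldl extend σ (phase (suc k)))

    run-proper : ∀ k → Proper k σ → Proper 0 (run k σ)
    run-proper zero    P = foldl-extend-proper (phase 0) ready P
    run-proper (suc k) P = run-proper k (Proper-weaken (n≤1+n k) (foldl-extend-proper (phase (suc k)) ready P))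

    private
      run-keeps : ∀ k σ → Coloured σ a b → Coloured (run k σ) a b
      run-keeps zero    σ coloured = foldl-extend-keeps σ (phase 0) coloured
      run-keeps (suc k) σ coloured = run-keeps k _ (foldl-extend-keeps σ (phase (suc k)) coloured)

    run-colours : ∀ k σ {m} → m ≤ k → (u , v) ∈ phase m → Coloured (run k σ) u v
    run-colours zero    σ z≤n uv∈phase = foldl-extend-colours σ (phase 0) uv∈phase
    run-colours (suc k) σ {m} m≤1+k uv∈phase with m≤n⇒m<n∨m≡n m≤1+k
    ... | inj₁ m<1+k = run-colours k _ (≤-pred m<1+k) uv∈phase
    ... | inj₂ refl  = run-keeps k _ (foldl-extend-colours σ (phase (suc k)) uv∈phase)

module StrongColouring (G : Graph) (regular : Regular 4 G) (girth : GirthAtLeast 6 G) where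

  open Basics G
  open Balls G
  open Roots G 5
  open Girth G girth
  open ForbiddenColours G regular

  RootAdjacent : V → Set
  RootAdjacent a = ∃[ r ] Adj G a r × T (roots r)

  rootAdjacent? : ∀ a → Dec (RootAdjacent a)
  rootAdjacent? a = any? λ r → T? (adj G a r) ×-dec T? (roots r)

  pendant : V → Maybe V
  pendant a = find (λ t → ¬? (T? (roots t))) (N a)

  Pendant : V → V → Set
  Pendant a b = RootAdjacent a × pendant a ≡ just b

  Special : V → V → Set
  Special a b = Pendant a b ⊎ Pendant b a

  special? : ∀ a b → Dec (Special a b)
  special? a b = (rootAdjacent? a ×-dec ≡-dec _≟_ (pendant a) (just b))
          ⊎-dec (rootAdjacent? b ×-dec ≡-dec _≟_ (pendant b) (just a))

  private variable
    a b c d u v r : V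

  root-neighbour-unique : Adj G a r → Adj G a b → T (roots r) → T (roots b) → r ≡ b
  root-neighbour-unique {a} {r} {b} ar ab root-r root-b with r ≟ b
  ... | yes r≡b = r≡b
  ... | no r≢b  = ⊥-elim (roots-scattered root-r root-b r≢b (two-steps ar ab) (two-steps ab ar))
    where
    two-steps : ∀ {x y} → Adj G a x → Adj G a y → Within 5 (singleton x) y
    two-steps ax ay = within-≤ (from-yes (2 ≤? 5)) (within-step (within-step (centre _) ax) (Adj-sym ay))

  pendant-sound : pendant a ≡ just b → Adj G a b × ¬ T (roots b)
  pendant-sound a↦b with b∈N , non-root ← find-sound (λ t → ¬? (T? (roots t))) a↦b = ∈-N⁻ b∈N , non-root

  pendant-exists : RootAdjacent a → ∃[ b ] pendant a ≡ just b
  pendant-exists {a} (r , ar , root-r) with t , at , t≢r ← neighbour-other-than a r =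
    find-complete (λ t → ¬? (T? (roots t))) (∈-N⁺ at) λ root-t → t≢r (sym (root-neighbour-unique ar at root-r root-t))

  private
    close-edges-roots-within : Adj G a r → Adj G a b → Adj G c v → Adj G c d → CloseV a b c d → Within 5 (singleton r) v
    close-edges-roots-within {a} {r} {b} {c} {v} {d} ar ab cv cd (_ , _ , x∈ab , y∈cd , near) =
      onward y∈cd (within-near (outward x∈ab) near)
      where
      outward : ∀ {x} → x ≡ a ⊎ x ≡ b → Within 2 (singleton r) x
      outward (inj₁ refl) = within-suc (within-step (centre r) ar)
      outward (inj₂ refl) = within-step (within-step (centre r) ar) (Adj-sym ab)
      onward : ∀ {y} → y ≡ c ⊎ y ≡ d → Within 3 (singleton r) y → Within 5 (singleton r) v
      onward (inj₁ refl) h = within-suc (within-step h (Adj-sym cv))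
      onward (inj₂ refl) h = within-step (within-step h cd) (Adj-sym cv)

  pendant-edges-apart : Pendant a b → Pendant c d → ¬ SameEdge a b c d → ¬ CloseV a b c d
  pendant-edges-apart {a} {b} {c} {d} ((r , ar , root-r) , a↦b) ((s , cs , root-s) , c↦d) other close
    with pendant-sound a↦b | pendant-sound c↦d | a ≟ c | r ≟ s
  ... | _ | _ | yes refl | _ = other (inj₁ (refl , just-injective (trans (sym a↦b) c↦d)))
  ... | ab , _ | cd , _ | no _ | no r≢s =
    roots-scattered root-r root-s r≢s
      (close-edges-roots-within ar ab cs cd close) (close-edges-roots-within cs cd ar ab (CloseV-sym close))
  ... | ab , non-root-b | cd , non-root-d | no a≢c | yes refl =
    hanging-edges-not-close ar cs ab (λ { refl → non-root-b root-r }) cd (λ { refl → non-root-d root-s }) a≢c close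

  special-edges-apart : Special a b → Special c d → ¬ SameEdge a b c d → ¬ CloseV a b c d
  special-edges-apart (inj₁ p) (inj₁ q) other = pendant-edges-apart p q other
  special-edges-apart (inj₁ p) (inj₂ q) other =
    pendant-edges-apart p q (other ∘ SameEdge-swapʳ) ∘ CloseV-swapʳ
  special-edges-apart (inj₂ p) (inj₁ q) other =
    pendant-edges-apart p q (other ∘ SameEdge-swapˡ) ∘ CloseV-swapˡ
  special-edges-apart (inj₂ p) (inj₂ q) other =
    pendant-edges-apart p q (other ∘ SameEdge-swapˡ ∘ SameEdge-swapʳ) ∘ CloseV-swapˡ ∘ CloseV-swapʳ

  open Greedy G regular Special Data.Sum.swap level

  private variable
    m : ℕ
    σ : PartialColouring

  special-uncoloured : Proper m σ → Special a b → σ a b ≡ nothing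
  special-uncoloured {σ = σ} {a} {b} P special with σ a b in ab↦
  ... | nothing = refl
  ... | just _  = ⊥-elim (proj₁ (proj₂ (Proper.support P ab↦)) special)

  below-uncoloured : Proper m σ → level a < m → BareAt σ a
  below-uncoloured {σ = σ} {a} P a<m z with σ a z in az↦
  ... | nothing = refl
  ... | just _  = ⊥-elim (<⇒≱ a<m (proj₁ (proj₂ (proj₂ (Proper.support P az↦)))))

  root-neighbour-bare : Proper m σ → T (roots r) → Adj G r a → HasBareEdge σ a r
  root-neighbour-bare P root-r ra with b , a↦b ← pendant-exists (_ , Adj-sym ra , root-r)
                                   with ab , non-root-b ← pendant-sound a↦b =
    b , ab , (λ { refl → non-root-b root-r }) , special-uncoloured P (inj₁ ((_ , Adj-sym ra , root-r) , a↦b))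

  InPhase : ℕ → V × V → Set
  InPhase m (u , v) = Adj G u v × ¬ Special u v × level u ≡ m × level u ≤ level v

  slack : InPhase m (u , v) → Proper m σ → Slack σ u v
  slack {u = u} {v} (uv , _ , refl , u≤v) P with level u in level-u
  ... | zero  = inj₂ ((λ uy _ → root-neighbour-bare P root-u uy) , root-neighbour-bare P root-u uv)
    where root-u = level-zero level-u
  ... | suc j with p , up , p≤j ← level-suc level-u =
    inj₁ (p , up , (λ { refl → 1+n≰n (≤-trans u≤v p≤j) }) , below-uncoloured P (s≤s p≤j))

  allPairs : List (V × V)
  allPairs = cartesianProduct (allFin (n G)) (allFin (n G))

  inPhase? : ∀ m e → Dec (InPhase m e)
  inPhase? m (u , v) = T? (adj G u v) ×-dec ¬? (special? u v) ×-dec level u ≟ℕ m ×-dec level u ≤? level v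

  phase : ℕ → List (V × V)
  phase m = filter (inPhase? m) allPairs

  phase-ready : ∀ {m e} → e ∈ phase m → Ready m e
  phase-ready {m} {u , v} e∈phase
    with _ , in-phase@(uv , plain , refl , u≤v) ← ∈-filter⁻ (inPhase? m) {xs = allPairs} e∈phase =
    uv , plain , ≤-refl , u≤v , slack in-phase

  ∈-phase : Adj G u v → ¬ Special u v → level u ≤ level v → (u , v) ∈ phase (level u)
  ∈-phase {u} {v} uv plain u≤v =
    ∈-filter⁺ (inPhase? (level u)) (∈-cartesianProduct⁺ (∈-allFin u) (∈-allFin v)) (uv , plain , refl , u≤v)

  open Phases phase phase-ready

  σ⋆ : PartialColouring
  σ⋆ = run 5 (λ _ _ → nothing)

  σ⋆-proper : Proper 0 σ⋆
  σ⋆-proper = run-proper 5 (Proper-empty 5)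

  plain-coloured : Adj G u v → ¬ Special u v → Coloured σ⋆ u v
  plain-coloured {u} {v} uv plain with ≤-total (level u) (level v)
  ... | inj₁ u≤v = run-colours 5 _ (level-≤ u) (∈-phase uv plain u≤v)
  ... | inj₂ v≤u with x , vu↦x ← run-colours 5 _ (level-≤ v) (∈-phase (Adj-sym uv) (plain ∘ Data.Sum.swap) v≤u) =
    x , trans (Proper.symmetric σ⋆-proper u v) vu↦x

  paint : V → V → Fin 22
  paint u v with special? u v | σ⋆ u v
  ... | yes _ | _       = Fin.zero
  ... | no _  | just x  = Fin.suc x
  ... | no _  | nothing = Fin.zero -- unreachable, by plain-coloured

  private
    paint-special : Special u v → paint u v ≡ Fin.zero
    paint-special {u} {v} special with special? u v
    ... | yes _ = refl
    ... | no ¬special = ⊥-elim (¬special special)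

    paint-plain : ∀ {x} → ¬ Special u v → σ⋆ u v ≡ just x → paint u v ≡ Fin.suc x
    paint-plain {u} {v} plain uv↦x with special? u v
    ... | yes special = ⊥-elim (plain special)
    ... | no _ rewrite uv↦x = refl

  paint-strong : Adj G u v → Adj G c d → ¬ SameEdge u v c d → CloseV u v c d → paint u v ≢ paint c d
  paint-strong {u} {v} {c} {d} uv cd other close = by-cases (special? u v) (special? c d)
    where
    by-cases : Dec (Special u v) → Dec (Special c d) → paint u v ≢ paint c d
    by-cases (yes s) (yes s′) _ = special-edges-apart s s′ other close
    by-cases (yes s) (no p′) eq with y , cd↦y ← plain-coloured cd p′ =
      Finₚ.0≢1+n (trans (sym (paint-special s)) (trans eq (paint-plain p′ cd↦y)))
    by-cases (no p) (yes s′) eq with x , uv↦x ← plain-coloured uv p =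
      Finₚ.0≢1+n (trans (sym (paint-special s′)) (trans (sym eq) (paint-plain p uv↦x)))
    by-cases (no p) (no p′) eq with x , uv↦x ← plain-coloured uv p | y , cd↦y ← plain-coloured cd p′ =
      Proper.strong σ⋆-proper uv↦x cd↦y other close
        (Finₚ.suc-injective (trans (sym (paint-plain p uv↦x)) (trans eq (paint-plain p′ cd↦y))))

  colour : Edge G → Fin 22
  colour (u , v , _) = paint u v

  colour-strong : IsStrongEdgeColoring G 22 colour
  colour-strong (u , v , u<v , uv) (c , d , c<d , cd) distinct =
    paint-strong uv cd [ distinct , (λ { (refl , refl) → <-asym u<v c<d }) ]

lemma3 : (G : Graph) → Regular 4 G → GirthAtLeast 6 G → HasStrongEdgeColoring G 22
lemma3 G regular girth = colour , colour-strong
  where open StrongColouring G regular girth
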